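{- Let $t$ be a positive integer, let $\mathcal A\in I(n,t)$ be maximal, fixed and compressed, let $g\in G_*(\mathcal A)$, choose $\hat E\in g$ with $s^+(\hat E)=s^+(g)$, and let $\hat E'=\hat E\setminus\{s^+(\hat E)\}$. Define $\mathscr D(\hat E)=\{\sigma\in S_n:\mathrm{fix}(\sigma)\cap[s^+(\hat E)]=\hat E\}$ and $\mathscr D'(\hat E)=\{\sigma\in S_n:\mathrm{fix}(\sigma)\cap[s^+(\hat E)-1]=\hat E'\}$. Then $\mathscr D'(\hat E)=\mathscr U_p(\hat E')\setminus\mathscr U_p(g\setminus\{\hat E\})$, i.e. it is the set of all permutations generated by $\hat E'$ and not by $g\setminus\{\hat E\}$. Furthermore, $|\mathscr D'(\hat E)|\ge(n-|\hat E|+1)\,|\mathscr D(\hat E)|$.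
   Context: $S_n$ is the symmetric group on $[n]=\{1,\dots,n\}$; $\mathrm{fix}(\sigma)=\{x:\sigma(x)=x\}$; $[m]=\{1,\dots,m\}$. Two permutations have a cycle in common if that cycle appears in both cycle decompositions (1-cycles count). $\mathcal A\subseteq S_n$ is $t$-cycle-intersecting if any two distinct members have at least $t$ common cycles; $I(n,t)$ is the collection of all such families; $\mathcal A\in I(n,t)$ is maximal if no $\sigma\notin\mathcal A$ can be added keeping the property. Fixing: for $i\ne j$, ${}_{[ij]}\sigma=\sigma$ if $\sigma(i)\ne j$; if $\sigma(i)=j$, ${}_{[ij]}\sigma(i)=i$, ${}_{[ij]}\sigma(\sigma^{ -1}(i))=j$, ${}_{[ij]}\sigma(x)=\sigma(x)$ otherwise; $\triangleleft_{ij}(\mathcal A)=\{\triangleleft_{ij}(\sigma):\sigma\in\mathcal A\}$ with $\triangleleft_{ij}(\sigma)={}_{[ij]}\sigma$ if ${}_{[ij]}\sigma\notin\mathcal A$, else $\sigma$; $\mathcal A$ is fixed if $\triangleleft_{ij}(\mathcal A)=\mathcal A$ for all $i\ne j$. Compression: for $i<j$, $\sigma_{i,j}=\sigma$ if $\sigma(i)=i$ or $\sigma(j)\ne j$; otherwise $\sigma_{i,j}(i)=i$, $\sigma_{i,j}(j)=\sigma(i)$, $\sigma_{i,j}(\sigma^{ -1}(i))=j$, $\sigma_{i,j}(y)=\sigma(y)$ otherwise; $\mathcal C_{i,j}(\mathcal A)=\{\mathcal C_{i,j}(\sigma):\sigma\in\mathcal A\}$ with $\mathcal C_{i,j}(\sigma)=\sigma_{i,j}$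 if $\sigma_{i,j}\notin\mathcal A$, else $\sigma$; $\mathcal A$ is compressed if $\mathcal C_{i,j}(\mathcal A)=\mathcal A$ for all $i<j$. $\mathscr U_p(B)=\{\sigma: B\subseteq\mathrm{fix}(\sigma)\}$, $\mathscr U_p(\mathcal B)=\bigcup_{B\in\mathcal B}\mathscr U_p(B)$; a generating set for $\mathcal A$ is a collection $g$ of subsets of $[n]$ with no set of size $n-1$ and $\mathscr U_p(g)=\mathcal A$; $G(\mathcal A)$ is the set of generating sets. For $B=\{b_1<\dots<b_k\}$, $\mathscr L(B)=\{\{a_1<\dots<a_k\}\subseteq[n]: a_i\le b_i\ \forall i\}$; $\mathscr L(g)=\bigcup_{B\in g}\mathscr L(B)$; $\mathscr L_*(g)$ is the set of inclusion-minimal elements of $\mathscr L(g)$. $G_*(\mathcal A)=\{g\in G(\mathcal A):\mathscr L_*(g)=g\}$. $s^+(E)$ is the largest element of $E$, and $s^+(g)=\max_{E\in g}s^+(E)$. -}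

module Defs where

open import Data.Nat as ℕ using (ℕ; zero; suc; _≤_; _<_; _⊔_; _≤ᵇ_; _≡ᵇ_)
open import Data.Bool using (Bool; true; false; _∧_; not; if_then_else_)
import Data.Bool.Properties as BoolP
open import Data.Fin using (Fin; toℕ; _≟_)
import Data.Fin as Fin
open import Data.Fin.Properties using (all?)
open import Data.Fin.Subset using (Subset; _∈_; _⊆_; _∩_; ∣_∣)
open import Data.Fin.Subset.Properties using (_∈?_)
open import Data.Vec using (Vec; []; _∷_; lookup; tabulate)
open import Data.Vec.Properties using (≡-dec)
open import Data.List using (List; []; _∷_; map; concatMap; filter; length; allFin; upTo; foldr)
open import Data.List.Relation.Binary.Pointwise using (Pointwise)
open import Data.Product using (Σ; ∃; _×_; _,_)
open import Data.Sum using (_⊎_)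
open import Relation.Nullary using (¬_; Dec; does)
open import Relation.Nullary.Decidable using (_×-dec_; _→-dec_; ⌊_⌋)
open import Relation.Unary using (Decidable)
open import Relation.Binary.PropositionalEquality using (_≡_; _≢_)
open import Function.Bundles using (_⇔_)

-- Points of [n] are represented by Fin n: x : Fin n stands for toℕ x + 1.
-- A "permutation" is a vector of images σ = (σ(0),…,σ(n-1)); it lies in
-- S_n iff it is injective.

Arr : ℕ → Set
Arr n = Vec (Fin n) n

ap : ∀ {n} → Arr n → Fin n → Fin n
ap σ x = lookup σ x

IsPerm : ∀ {n} → Arr n → Set
IsPerm σ = ∀ x y → ap σ x ≡ ap σ y → x ≡ y

IsPerm? : ∀ {n} → Decidable (IsPerm {n})
IsPerm? σ = all? (λ x → all? (λ y → (ap σ x ≟ ap σ y) →-dec (x ≟ y)))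

Family : ℕ → Set₁
Family n = Arr n → Set

allVecs' : ∀ n k → List (Vec (Fin n) k)
allVecs' n zero = [] ∷ []
allVecs' n (suc k) = concatMap (λ x → map (x ∷_) (allVecs' n k)) (allFin n)

card : ∀ {n} (P : Family n) → Decidable P → ℕ
card {n} P P? = length (filter P? (allVecs' n n))

fix : ∀ {n} → Arr n → Subset n
fix σ = tabulate (λ x → does (ap σ x ≟ x))

-- [m] = {1,…,m}  (point x : Fin n is the number toℕ x + 1)
upto : ∀ {n} → ℕ → Subset n
upto m = tabulate (λ x → suc (toℕ x) ≤ᵇ m)

-- s⁺(E): largest element (0 for the empty set)
s⁺ : ∀ {n} → Subset n → ℕ
s⁺ {n} E = foldr _⊔_ 0 (map (λ x → if does (x ∈? E) then suc (toℕ x) else 0) (allFin n))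

dropMax : ∀ {n} → Subset n → Subset n
dropMax E = tabulate (λ x → lookup E x ∧ not (suc (toℕ x) ≡ᵇ s⁺ E))

allB : ∀ {A : Set} → (A → Bool) → List A → Bool
allB p = foldr (λ a b → p a ∧ b) true

iter : ∀ {n} → Arr n → ℕ → Fin n → Fin n
iter σ zero x = x
iter σ (suc k) x = ap σ (iter σ k x)

orbit : ∀ {n} → Arr n → Fin n → List (Fin n)
orbit {n} σ x = map (λ k → iter σ k x) (upTo n)

orbitMin : ∀ {n} → Arr n → Fin n → Bool
orbitMin σ x = allB (λ y → toℕ x ≤ᵇ toℕ y) (orbit σ x)

-- τ acts like σ on the σ-cycle of x (i.e. that cycle of σ is also a cycle of τ)
agreeOn : ∀ {n} → Arr n → Arr n → Fin n → Bool
agreeOn σ τ x = allB (λ y → does (ap τ y ≟ ap σ y)) (orbit σ x)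

-- number of cycles (1-cycles included) common to σ and τ
commonCycles : ∀ {n} → Arr n → Arr n → ℕ
commonCycles {n} σ τ = length (filter (λ x → orbitMin σ x ∧ agreeOn σ τ x ≟B true) (allFin n))
  where open BoolP renaming (_≟_ to _≟B_)

TCycleIntersecting : ∀ {n} → ℕ → Family n → Set
TCycleIntersecting t 𝒜 =
  (∀ σ → 𝒜 σ → IsPerm σ) ×
  (∀ σ τ → 𝒜 σ → 𝒜 τ → σ ≢ τ → t ≤ commonCycles σ τ)

Maximal : ∀ {n} → ℕ → Family n → Set
Maximal t 𝒜 = TCycleIntersecting t 𝒜 ×
  (∀ σ → IsPerm σ → ¬ 𝒜 σ → ¬ TCycleIntersecting t (λ τ → 𝒜 τ ⊎ τ ≡ σ))

_≐_ : ∀ {n} → Family n → Family n → Set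
𝒜 ≐ ℬ = ∀ σ → 𝒜 σ ⇔ ℬ σ

-- image of 𝒜 under the operation "replace σ by f σ unless f σ is already in 𝒜"
opImage : ∀ {n} → (Arr n → Arr n) → Family n → Family n
opImage f 𝒜 τ = ∃ λ σ → 𝒜 σ × ((¬ 𝒜 (f σ) × τ ≡ f σ) ⊎ (𝒜 (f σ) × τ ≡ σ))

fixing : ∀ {n} → Fin n → Fin n → Arr n → Arr n
fixing i j σ with does (ap σ i ≟ j)
... | false = σ
... | true = tabulate (λ x → if does (x ≟ i) then i
                             else if does (ap σ x ≟ i) then j
                             else ap σ x)

Fixed : ∀ {n} → Family n → Set
Fixed {n} 𝒜 = ∀ (i j : Fin n) → i ≢ j → opImage (fixing i j) 𝒜 ≐ 𝒜

compress : ∀ {n} → Fin n → Fin n → Arr n → Arr n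
compress i j σ with does (ap σ i ≟ i) | does (ap σ j ≟ j)
... | false | true = tabulate (λ x → if does (x ≟ i) then i
                                     else if does (x ≟ j) then ap σ i
                                     else if does (ap σ x ≟ i) then j
                                     else ap σ x)
... | _ | _ = σ

Compressed : ∀ {n} → Family n → Set
Compressed {n} 𝒜 = ∀ (i j : Fin n) → i Fin.< j → opImage (compress i j) 𝒜 ≐ 𝒜

SetFam : ℕ → Set₁
SetFam n = Subset n → Set

Up : ∀ {n} → Subset n → Family n
Up B σ = IsPerm σ × B ⊆ fix σ

Upg : ∀ {n} → SetFam n → Family n
Upg g σ = ∃ λ B → g B × Up B σ

IsGenerating : ∀ {n} → Family n → SetFam n → Set
IsGenerating {n} 𝒜 g = (∀ B → g B → ∣ B ∣ ≢ n ℕ.∸ 1) × (Upg g ≐ 𝒜)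

elems : ∀ {n} → Subset n → List ℕ
elems {n} E = map toℕ (filter (_∈? E) (allFin n))

-- A ∈ 𝓛(B):  |A| = |B| and a_i ≤ b_i
InL : ∀ {n} → Subset n → Subset n → Set
InL A B = Pointwise _≤_ (elems A) (elems B)

Lg : ∀ {n} → SetFam n → SetFam n
Lg g A = ∃ λ B → g B × InL A B

L* : ∀ {n} → SetFam n → SetFam n
L* g A = Lg g A × (∀ A' → Lg g A' → A' ⊆ A → A' ≡ A)

IsGenerating* : ∀ {n} → Family n → SetFam n → Set
IsGenerating* 𝒜 g = IsGenerating 𝒜 g × (∀ A → L* g A ⇔ g A)

𝒟 : ∀ {n} → Subset n → Family n
𝒟 E σ = IsPerm σ × (fix σ ∩ upto (s⁺ E) ≡ E)

𝒟' : ∀ {n} → Subset n → Family n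
𝒟' E σ = IsPerm σ × (fix σ ∩ upto (s⁺ E ℕ.∸ 1) ≡ dropMax E)

𝒟? : ∀ {n} (E : Subset n) → Decidable (𝒟 E)
𝒟? E σ = IsPerm? σ ×-dec ≡-dec BoolP._≟_ (fix σ ∩ upto (s⁺ E)) E

𝒟'? : ∀ {n} (E : Subset n) → Decidable (𝒟' E)
𝒟'? E σ = IsPerm? σ ×-dec ≡-dec BoolP._≟_ (fix σ ∩ upto (s⁺ E ℕ.∸ 1)) (dropMax E)

module Submission where

-- Such an s exists because Ê ≠ ∅: otherwise 𝒜 = S_n, which contains the identity and a cyclic
-- shift sharing no cycle.  Both 𝒟(Ê) and 𝒟'(Ê) are then described pointwise ('SameBelow').
-- (1) '⊆': a generator B ⊆ fix σ of σ ∈ 𝒟'(Ê) lies in [s], hence B ⊆ Ê, so B = Ê by minimality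
--     of g.  '⊇': if σ fixes Ê ∖ {s} and also some x ∉ Ê below s, then σ (or σ (s c) for a
--     second point c ∉ Ê, which exists as |Ê| ≠ n - 1) is the compression C_{x,s} of the
--     conjugate (x s) σ (x s) ⊇ Ê, so it lies in 𝒜 and is generated by g ∖ {Ê}.
-- (2) (σ , y) ↦ σ (s y) is an injection from 𝒟(Ê) × ({s} ∪ ([n] ∖ Ê)) into 𝒟'(Ê).

open import Defs
open import Data.Nat using (ℕ; _≤_; _*_; _+_; _∸_)
open import Data.Fin.Subset using (Subset; ∣_∣)
open import Data.Product using (_×_)
open import Relation.Nullary using (¬_)
open import Relation.Binary.PropositionalEquality using (_≢_)

open import Data.Nat using (zero; suc; _<_; _⊔_; z≤n; s≤s)
import Data.Nat.Properties as ℕP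
open import Data.Bool using (Bool; true; false; T; not; _∧_; if_then_else_)
open import Data.Bool.Properties using (T-≡; T-∧) renaming (_≟_ to _≟ᵇ_)
open import Data.Empty using (⊥; ⊥-elim)
open import Data.Unit using (tt)
open import Data.Fin using (Fin; toℕ; _≟_)
import Data.Fin as Fin
import Data.Fin.Properties as FinP
open import Data.Fin.Permutation.Components using (transpose; transpose-inverse)
open import Data.Fin.Subset using (_∈_; _∉_; _⊆_; _∩_; ∁; ⁅_⁆; Nonempty)
open import Data.Fin.Subset.Properties
  using (_∈?_; x∈p∩q⁺; x∈p∩q⁻; ⊆-antisym; x∈⁅x⁆; x∈⁅y⁆⇒x≡y; nonempty?; Empty-unique; ∣⊥∣≡0;
         x∈∁p⇒x∉p; x∉p⇒x∈∁p; ∣∁p∣≡n∸∣p∣; ∣⁅x⁆∣≡1; ∣p∣≤n)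
open import Data.Vec using (Vec; lookup; tabulate)
import Data.Vec as Vec
open import Data.Vec.Properties
  using (∷-injective; lookup∘tabulate; tabulate∘lookup; tabulate-cong; []=⇒lookup; lookup⇒[]=)
open import Data.List
  using (List; []; _∷_; _++_; map; filter; foldr; allFin; length; concatMap; cartesianProduct; cartesianProductWith)
import Data.List.Properties as ListP
open import Data.List.Relation.Unary.All as All using (All)
open import Data.List.Membership.Propositional using () renaming (_∈_ to _∈ₗ_)
open import Data.List.Membership.Propositional.Properties
  using (∈-map⁺; ∈-map⁻; ∈-allFin; foldr-selective; ∈-∃++; ∈-++⁻; ∈-++⁺ˡ; ∈-++⁺ʳ; ∈-filter⁺; ∈-filter⁻;
         ∈-cartesianProductWith⁺; ∈-cartesianProduct⁻)
open import Data.List.Relation.Unary.AllPairs using (AllPairs)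
open import Data.List.Relation.Unary.Unique.Propositional using (Unique)
import Data.List.Relation.Unary.Unique.Propositional.Properties as Unique
import Data.List.Relation.Unary.All.Properties as All
open import Data.List.Relation.Unary.Any using (here; there)
open import Data.Product using (∃; _,_; proj₁; proj₂; uncurry)
import Data.List.Relation.Binary.Pointwise as Pointwise
open import Data.Sum using (_⊎_; inj₁; inj₂; [_,_])
open import Relation.Unary using (Decidable)
open import Function using (_∘_)
open import Function.Bundles using (_⇔_; mk⇔; Equivalence)
open import Function.Properties.Equivalence using () renaming (trans to ⇔-trans; sym to ⇔-sym)
open import Relation.Nullary using (Dec; yes; no; does; ¬?; _×-dec_)
open import Relation.Nullary.Decidable using (dec-true; dec-false)
open import Relation.Binary.PropositionalEquality using (_≡_; refl; sym; trans; cong; cong₂; subst; module ≡-Reasoning)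

open Equivalence using (to; from)

T-does⇔ : ∀ {a} {A : Set a} (d : Dec A) → T (does d) ⇔ A
T-does⇔ (yes a) = mk⇔ (λ _ → a) (λ _ → tt)
T-does⇔ (no ¬a) = mk⇔ (λ ()) ¬a

T-not⇔ : ∀ {b} → T (not b) ⇔ (¬ T b)
T-not⇔ {true} = mk⇔ (λ ()) (λ ¬t → ¬t tt)
T-not⇔ {false} = mk⇔ (λ _ ()) (λ _ → tt)

∈⇔T-lookup : ∀ {n} {p : Subset n} {x} → x ∈ p ⇔ T (lookup p x)
∈⇔T-lookup {p = p} {x} = mk⇔ (λ x∈p → from T-≡ ([]=⇒lookup x∈p)) (λ t → lookup⇒[]= x p (to T-≡ t))

∈-tabulate⇔ : ∀ {n} (f : Fin n → Bool) {x} → x ∈ tabulate f ⇔ T (f x)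
∈-tabulate⇔ f {x} = subst (λ b → x ∈ tabulate f ⇔ T b) (lookup∘tabulate f x) ∈⇔T-lookup

∈fix⇔ : ∀ {n} (σ : Arr n) {x} → x ∈ fix σ ⇔ ap σ x ≡ x
∈fix⇔ σ {x} = ⇔-trans (∈-tabulate⇔ _) (T-does⇔ (ap σ x ≟ x))

∈upto⇔ : ∀ {n} {m} {x : Fin n} → x ∈ upto m ⇔ toℕ x < m
∈upto⇔ {m = m} {x} = ⇔-trans (∈-tabulate⇔ _) (mk⇔ (ℕP.≤ᵇ⇒≤ (suc (toℕ x)) m) ℕP.≤⇒≤ᵇ)

∈dropMax⇔ : ∀ {n} {E : Subset n} {x} → x ∈ dropMax E ⇔ (x ∈ E × suc (toℕ x) ≢ s⁺ E)
∈dropMax⇔ {E = E} {x} = ⇔-trans (∈-tabulate⇔ _) (⇔-trans T-∧ (mk⇔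
  (λ (a , b) → from ∈⇔T-lookup a , λ e → to T-not⇔ b (ℕP.≡⇒≡ᵇ _ _ e))
  (λ (a , b) → to ∈⇔T-lookup a , from T-not⇔ (b ∘ ℕP.≡ᵇ⇒≡ _ _))))

SameBelow : ∀ {n} → ℕ → Subset n → Subset n → Set
SameBelow m p q = ∀ x → toℕ x < m → x ∈ p ⇔ x ∈ q

∩upto≡⇒SameBelow : ∀ {n} {m} {p q : Subset n} → p ∩ upto m ≡ q → SameBelow m p q
∩upto≡⇒SameBelow {p = p} refl x x<m =
  mk⇔ (λ x∈p → x∈p∩q⁺ (x∈p , from ∈upto⇔ x<m)) (proj₁ ∘ x∈p∩q⁻ p _)

SameBelow⇒∩upto≡ : ∀ {n} {m} {p q : Subset n} → SameBelow m p q → (∀ x → x ∈ q → toℕ x < m) →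
                   p ∩ upto m ≡ q
SameBelow⇒∩upto≡ {p = p} same bounded = ⊆-antisym
  (λ x∈ → let x∈p , x∈[m] = x∈p∩q⁻ p _ x∈ in to (same _ (to ∈upto⇔ x∈[m])) x∈p)
  (λ {x} x∈q → x∈p∩q⁺ (from (same x (bounded x x∈q)) x∈q , from ∈upto⇔ (bounded x x∈q)))

transpose-matchˡ : ∀ {n} (i j : Fin n) → transpose i j i ≡ j
transpose-matchˡ i j rewrite dec-true (i ≟ i) refl = refl

transpose-matchʳ : ∀ {n} (i j : Fin n) → transpose i j j ≡ i
transpose-matchʳ i j with j ≟ i
... | yes j≡i = j≡i
... | no _ rewrite dec-true (j ≟ j) refl = refl

transpose-other : ∀ {n} {i j k : Fin n} → k ≢ i → k ≢ j → transpose i j k ≡ k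
transpose-other {i = i} {j} {k} k≢i k≢j rewrite dec-false (k ≟ i) k≢i | dec-false (k ≟ j) k≢j = refl

transpose-injective : ∀ {n} (i j : Fin n) {x y} → transpose i j x ≡ transpose i j y → x ≡ y
transpose-injective i j {x} {y} e =
  trans (sym (transpose-inverse j i)) (trans (cong (transpose j i) e) (transpose-inverse j i))

arr-ext : ∀ {A : Set} {n} {u v : Vec A n} → (∀ x → lookup u x ≡ lookup v x) → u ≡ v
arr-ext {u = u} {v} h = trans (sym (tabulate∘lookup u)) (trans (tabulate-cong h) (tabulate∘lookup v))

_⊙_ : ∀ {n} → Arr n → (Fin n → Fin n) → Arr n
σ ⊙ f = tabulate (λ x → ap σ (f x))

ap-⊙ : ∀ {n} (σ : Arr n) (f : Fin n → Fin n) x → ap (σ ⊙ f) x ≡ ap σ (f x)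
ap-⊙ σ f = lookup∘tabulate (λ x → ap σ (f x))

tabulate-perm : ∀ {n} (f : Fin n → Fin n) → (∀ {x y} → f x ≡ f y → x ≡ y) → IsPerm (tabulate f)
tabulate-perm f f-inj x y e = f-inj (trans (sym (lookup∘tabulate f x)) (trans e (lookup∘tabulate f y)))

⊙-perm : ∀ {n} (σ : Arr n) {f : Fin n → Fin n} → IsPerm σ → (∀ {x y} → f x ≡ f y → x ≡ y) →
         IsPerm (σ ⊙ f)
⊙-perm σ {f} σ-perm f-inj = tabulate-perm (λ x → ap σ (f x)) (f-inj ∘ σ-perm _ _)

⊙-transpose-other : ∀ {n} (σ : Arr n) {i j y : Fin n} → y ≢ i → y ≢ j → ap (σ ⊙ transpose i j) y ≡ ap σ y
⊙-transpose-other σ y≢i y≢j = trans (ap-⊙ σ _ _) (cong (ap σ) (transpose-other y≢i y≢j))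

⊙-cancel : ∀ {n} {σ σ' : Arr n} (f g : Fin n → Fin n) → (∀ x → f (g x) ≡ x) → σ ⊙ f ≡ σ' ⊙ f → σ ≡ σ'
⊙-cancel {σ = σ} {σ'} f g f∘g≡id e = arr-ext λ x → begin
  ap σ x           ≡⟨ cong (ap σ) (sym (f∘g≡id x)) ⟩
  ap σ (f (g x))   ≡⟨ sym (ap-⊙ σ f (g x)) ⟩
  ap (σ ⊙ f) (g x) ≡⟨ cong (λ ρ → ap ρ (g x)) e ⟩
  ap (σ' ⊙ f) (g x) ≡⟨ ap-⊙ σ' f (g x) ⟩
  ap σ' (f (g x))  ≡⟨ cong (ap σ') (f∘g≡id x) ⟩
  ap σ' x          ∎
  where open ≡-Reasoning

conjugate : ∀ {n} → Fin n → Fin n → Arr n → Arr n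
conjugate i j σ = tabulate (λ x → transpose i j (ap σ (transpose i j x)))

ap-conjugate : ∀ {n} (i j : Fin n) (σ : Arr n) x →
               ap (conjugate i j σ) x ≡ transpose i j (ap σ (transpose i j x))
ap-conjugate i j σ = lookup∘tabulate _

conjugate-perm : ∀ {n} (i j : Fin n) (σ : Arr n) → IsPerm σ → IsPerm (conjugate i j σ)
conjugate-perm i j σ σ-perm x y e = transpose-injective i j (σ-perm _ _ (transpose-injective i j
  (trans (sym (ap-conjugate i j σ x)) (trans e (ap-conjugate i j σ y)))))

compress-active : ∀ {n} (i j : Fin n) (τ : Arr n) → ap τ i ≢ i → ap τ j ≡ j →
  compress i j τ ≡ tabulate (λ x → if does (x ≟ i) then i
                                   else if does (x ≟ j) then ap τ i
                                   else if does (ap τ x ≟ i) then j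
                                   else ap τ x)
compress-active i j τ τi≢i τj≡j rewrite dec-false (ap τ i ≟ i) τi≢i | dec-true (ap τ j ≟ j) τj≡j = refl

compress-conjugate : ∀ {n} {i j : Fin n} (σ : Arr n) → IsPerm σ → i ≢ j → ap σ i ≡ i → ap σ j ≢ j →
                     compress i j (conjugate i j σ) ≡ σ
compress-conjugate {i = i} {j} σ σ-perm i≢j σi≡i σj≢j =
  trans (compress-active i j τ τi≢i τj≡j) (arr-ext λ x → trans (lookup∘tabulate _ x) (entry x))
  where
  τ = conjugate i j σ
  σ-moves-to-i : ∀ {x} → ap σ x ≡ i → x ≡ i
  σ-moves-to-i e = σ-perm _ _ (trans e (sym σi≡i))
  τ-off : ∀ {x} → x ≢ i → x ≢ j → ap τ x ≡ transpose i j (ap σ x)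
  τ-off x≢i x≢j = trans (ap-conjugate i j σ _) (cong (transpose i j ∘ ap σ) (transpose-other x≢i x≢j))
  τi≡σj : ap τ i ≡ ap σ j
  τi≡σj = trans (ap-conjugate i j σ i) (trans (cong (transpose i j ∘ ap σ) (transpose-matchˡ i j))
            (transpose-other (λ e → i≢j (sym (σ-moves-to-i e))) σj≢j))
  τi≢i : ap τ i ≢ i
  τi≢i e = i≢j (sym (σ-moves-to-i (trans (sym τi≡σj) e)))
  τj≡j : ap τ j ≡ j
  τj≡j = trans (ap-conjugate i j σ j) (trans (cong (transpose i j ∘ ap σ) (transpose-matchʳ i j))
           (trans (cong (transpose i j) σi≡i) (transpose-matchˡ i j)))
  entry : ∀ x → (if does (x ≟ i) then i
                 else if does (x ≟ j) then ap τ i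
                 else if does (ap τ x ≟ i) then j
                 else ap τ x) ≡ ap σ x
  entry x with x ≟ i | x ≟ j
  ... | yes refl | _ = sym σi≡i
  ... | no _ | yes refl = τi≡σj
  ... | no x≢i | no x≢j with ap τ x ≟ i
  ...   | yes τx≡i = sym (transpose-injective i j
            (trans (sym (τ-off x≢i x≢j)) (trans τx≡i (sym (transpose-matchʳ i j)))))
  ...   | no τx≢i = trans (τ-off x≢i x≢j) (transpose-other (x≢i ∘ σ-moves-to-i)
            (λ σx≡j → τx≢i (trans (τ-off x≢i x≢j) (trans (cong (transpose i j) σx≡j) (transpose-matchʳ i j)))))

height : ∀ {n} → Subset n → Fin n → ℕ
height E x = if does (x ∈? E) then suc (toℕ x) else 0

foldr-⊔-upper : ∀ {y} ys → y ∈ₗ ys → y ≤ foldr _⊔_ 0 ys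
foldr-⊔-upper (y ∷ ys) (here refl) = ℕP.m≤m⊔n y _
foldr-⊔-upper (z ∷ ys) (there y∈) = ℕP.≤-trans (foldr-⊔-upper ys y∈) (ℕP.m≤n⊔m z _)

height-∈ : ∀ {n} {E : Subset n} {x} → x ∈ E → height E x ≡ suc (toℕ x)
height-∈ {E = E} {x} x∈E with x ∈? E
... | yes _ = refl
... | no x∉E = ⊥-elim (x∉E x∈E)

s⁺-upper : ∀ {n} {E : Subset n} {x} → x ∈ E → suc (toℕ x) ≤ s⁺ E
s⁺-upper {E = E} {x} x∈E =
  subst (_≤ s⁺ E) (height-∈ x∈E) (foldr-⊔-upper _ (∈-map⁺ (height E) (∈-allFin x)))

s⁺-nonzero : ∀ {n} {E : Subset n} {x} → x ∈ E → s⁺ E ≢ 0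
s⁺-nonzero x∈E s⁺≡0 with subst (_ ≤_) s⁺≡0 (s⁺-upper x∈E)
... | ()

s⁺-attained : ∀ {n} {E : Subset n} → Nonempty E → ∃ λ s → s ∈ E × s⁺ E ≡ suc (toℕ s)
s⁺-attained {n} {E} (x , x∈E) with foldr-selective ℕP.⊔-sel 0 (map (height E) (allFin n))
... | inj₁ s⁺≡0 = ⊥-elim (s⁺-nonzero x∈E s⁺≡0)
... | inj₂ s⁺∈ with ∈-map⁻ (height E) s⁺∈
...   | s , _ , s⁺≡h with s ∈? E
...     | yes s∈E = s , s∈E , s⁺≡h
...     | no _ = ⊥-elim (s⁺-nonzero x∈E s⁺≡h)

-- From now on s is the largest element of E: s ∈ E and s⁺ E = s + 1 (points are 0-based).
-- Then dropMax E = E ∖ {s}, and 𝒟(E), 𝒟'(E) are described pointwise below s + 1, resp. below s.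
module TopElement {n} {E : Subset n} {s : Fin n} (s∈E : s ∈ E) (s⁺≡ : s⁺ E ≡ suc (toℕ s)) where

  ≤-top : ∀ {x} → x ∈ E → toℕ x ≤ toℕ s
  ≤-top x∈E = ℕP.≤-pred (subst (_ ≤_) s⁺≡ (s⁺-upper x∈E))

  <-top : ∀ {x} → x ∈ E → x ≢ s → toℕ x < toℕ s
  <-top x∈E x≢s = ℕP.≤∧≢⇒< (≤-top x∈E) (x≢s ∘ FinP.toℕ-injective)

  ∈E∖top⇔ : ∀ {x} → x ∈ dropMax E ⇔ (x ∈ E × x ≢ s)
  ∈E∖top⇔ = ⇔-trans ∈dropMax⇔ (mk⇔
    (λ (x∈E , x≠top) → x∈E , λ x≡s → x≠top (trans (cong (suc ∘ toℕ) x≡s) (sym s⁺≡)))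
    (λ (x∈E , x≢s) → x∈E , λ e → x≢s (FinP.toℕ-injective (ℕP.suc-injective (trans e s⁺≡)))))

  dropMax-SameBelow : SameBelow (toℕ s) (dropMax E) E
  dropMax-SameBelow x x<s = mk⇔ (proj₁ ∘ to ∈E∖top⇔)
    (λ x∈E → from ∈E∖top⇔ (x∈E , FinP.<⇒≢ x<s))

  𝒟⇔ : ∀ {σ} → 𝒟 E σ ⇔ (IsPerm σ × SameBelow (suc (toℕ s)) (fix σ) E)
  𝒟⇔ {σ} = mk⇔
    (λ (σ-perm , eq) → σ-perm , ∩upto≡⇒SameBelow (subst (λ k → fix σ ∩ upto k ≡ E) s⁺≡ eq))
    (λ (σ-perm , same) → σ-perm , subst (λ k → fix σ ∩ upto k ≡ E) (sym s⁺≡)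
                                         (SameBelow⇒∩upto≡ same (λ _ → s≤s ∘ ≤-top)))

  𝒟'⇔ : ∀ {σ} → 𝒟' E σ ⇔ (IsPerm σ × SameBelow (toℕ s) (fix σ) E)
  𝒟'⇔ {σ} = mk⇔
    (λ (σ-perm , eq) → σ-perm , λ x x<s → ⇔-trans
       (∩upto≡⇒SameBelow (subst (λ k → fix σ ∩ upto (k ∸ 1) ≡ dropMax E) s⁺≡ eq) x x<s)
       (dropMax-SameBelow x x<s))
    (λ (σ-perm , same) → σ-perm , subst (λ k → fix σ ∩ upto (k ∸ 1) ≡ dropMax E) (sym s⁺≡)
       (SameBelow⇒∩upto≡ (λ x x<s → ⇔-trans (same x x<s) (⇔-sym (dropMax-SameBelow x x<s)))
                         (λ _ x∈ → let x∈E , x≢s = to ∈E∖top⇔ x∈ in <-top x∈E x≢s)))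

Upg-mono : ∀ {n} {h : SetFam n} {ρ σ : Arr n} → IsPerm σ → fix ρ ⊆ fix σ → Upg h ρ → Upg h σ
Upg-mono σ-perm fixρ⊆fixσ (B , hB , _ , B⊆fixρ) = B , hB , σ-perm , λ x∈B → fixρ⊆fixσ (B⊆fixρ x∈B)

-- A generating set g ∈ G_*(𝒜) is an antichain: g = 𝓛_*(g) consists of ⊆-minimal sets.
generator-minimal : ∀ {n} {𝒜 : Family n} {g : SetFam n} {B E : Subset n} →
                    IsGenerating* 𝒜 g → g E → g B → B ⊆ E → B ≡ E
generator-minimal (_ , L*⇔g) gE gB B⊆E =
  proj₂ (from (L*⇔g _) gE) _ (_ , gB , Pointwise.refl ℕP.≤-refl) B⊆E

-- A compressed family is closed under each compression C_{i,j} (up to double negation,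
-- since membership in 𝒜 is not decidable).
compressed-closed : ∀ {n} {𝒜 : Family n} → Compressed 𝒜 → ∀ {i j} → i Fin.< j →
                    ∀ {τ} → 𝒜 τ → ¬ ¬ 𝒜 (compress i j τ)
compressed-closed comp i<j {τ} τ∈𝒜 ∉𝒜 =
  ∉𝒜 (to (comp _ _ i<j (compress _ _ τ)) (τ , τ∈𝒜 , inj₁ (∉𝒜 , refl)))

second-outside-point : ∀ {n} {E : Subset n} {x} → x ∉ E → ∣ E ∣ ≢ n ∸ 1 → ∃ λ c → c ∉ E × c ≢ x
second-outside-point {n} {E} {x} x∉E size with FinP.any? (λ c → ¬? (c ∈? E) ×-dec ¬? (c ≟ x))
... | yes found = found
... | no none = ⊥-elim (size ∣E∣≡n∸1)
  where
  outside-is-x : ∀ {c} → c ∈ ∁ E → c ≡ x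
  outside-is-x {c} c∈∁E with c ≟ x
  ... | yes c≡x = c≡x
  ... | no c≢x = ⊥-elim (none (c , x∈∁p⇒x∉p c∈∁E , c≢x))
  ∁E≡⁅x⁆ : ∁ E ≡ ⁅ x ⁆
  ∁E≡⁅x⁆ = ⊆-antisym (λ c∈∁E → subst (_∈ ⁅ x ⁆) (sym (outside-is-x c∈∁E)) (x∈⁅x⁆ x))
                     (λ c∈⁅x⁆ → subst (_∈ ∁ E) (sym (x∈⁅y⁆⇒x≡y x c∈⁅x⁆)) (x∉p⇒x∈∁p x∉E))
  ∣E∣≡n∸1 : ∣ E ∣ ≡ n ∸ 1
  ∣E∣≡n∸1 = begin
    ∣ E ∣             ≡⟨ sym (ℕP.m∸[m∸n]≡n (∣p∣≤n E)) ⟩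
    n ∸ (n ∸ ∣ E ∣)   ≡⟨ cong (n ∸_) (sym (∣∁p∣≡n∸∣p∣ E)) ⟩
    n ∸ ∣ ∁ E ∣       ≡⟨ cong (λ p → n ∸ ∣ p ∣) ∁E≡⁅x⁆ ⟩
    n ∸ ∣ ⁅ x ⁆ ∣     ≡⟨ cong (n ∸_) (∣⁅x⁆∣≡1 x) ⟩
    n ∸ 1             ∎
    where open ≡-Reasoning

-- Members of generating sets are nonempty: ∅ would generate all of S_n, which contains the
-- identity and the cyclic shift x ↦ x - 1, two permutations without a common cycle.

-- Arrays that differ at every point have no cycle in common (each orbit starts at its point).
nowhere-equal⇒no-common-cycle : ∀ {n} (σ τ : Arr n) → (∀ x → ap τ x ≢ ap σ x) → commonCycles σ τ ≡ 0
nowhere-equal⇒no-common-cycle {zero} σ τ _ = refl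
nowhere-equal⇒no-common-cycle {suc _} σ τ differ =
  cong length (ListP.filter-none (λ x → orbitMin σ x ∧ agreeOn σ τ x ≟ᵇ true)
                                {xs = allFin _} (All.tabulate λ {x} _ → not-common x))
  where
  not-common : ∀ x → ¬ (orbitMin σ x ∧ agreeOn σ τ x ≡ true)
  not-common x common = differ x (to (T-does⇔ (ap τ x ≟ ap σ x))
    (proj₁ (to (T-∧ {does (ap τ x ≟ ap σ x)}) (proj₂ (to (T-∧ {orbitMin σ x}) (from T-≡ common))))))

shift-down : ∀ {m} → Fin (suc m) → Fin (suc m)
shift-down Fin.zero = Fin.fromℕ _
shift-down (Fin.suc x) = Fin.inject₁ x

shift-down-injective : ∀ {m} {x y : Fin (suc m)} → shift-down x ≡ shift-down y → x ≡ y
shift-down-injective {x = Fin.zero} {Fin.zero} _ = refl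
shift-down-injective {x = Fin.zero} {Fin.suc _} e = ⊥-elim (FinP.fromℕ≢inject₁ e)
shift-down-injective {x = Fin.suc _} {Fin.zero} e = ⊥-elim (FinP.fromℕ≢inject₁ (sym e))
shift-down-injective {x = Fin.suc _} {Fin.suc _} e = cong Fin.suc (FinP.inject₁-injective e)

shift-down-moves : ∀ {k} (x : Fin (suc (suc k))) → shift-down x ≢ x
shift-down-moves Fin.zero ()
shift-down-moves (Fin.suc x) e =
  ℕP.<-irrefl (trans (sym (FinP.toℕ-inject₁ x)) (cong toℕ e)) (ℕP.n<1+n (toℕ x))

full-family-not-intersecting : ∀ {k t} {𝒜 : Family (suc (suc k))} → 1 ≤ t →
  (∀ σ τ → 𝒜 σ → 𝒜 τ → σ ≢ τ → t ≤ commonCycles σ τ) → (∀ σ → IsPerm σ → 𝒜 σ) → ⊥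
full-family-not-intersecting {k} {t} 1≤t intersecting all-in =
  ℕP.<⇒≱ 1≤t (subst (t ≤_) no-common t≤common)
  where
  identity shift : Arr (suc (suc k))
  identity = tabulate (λ x → x)
  shift = tabulate shift-down
  t≤common : t ≤ commonCycles identity shift
  t≤common = intersecting identity shift (all-in _ (tabulate-perm (λ x → x) (λ e → e)))
               (all-in _ (tabulate-perm shift-down shift-down-injective)) identity≢shift
    where
    identity≢shift : identity ≢ shift
    identity≢shift e with cong (λ v → lookup v Fin.zero) e
    ... | ()
  no-common : commonCycles identity shift ≡ 0
  no-common = nowhere-equal⇒no-common-cycle identity shift λ x e →
    shift-down-moves x (trans (sym (lookup∘tabulate shift-down x)) (trans e (lookup∘tabulate (λ y → y) x)))

-- Every member of a generating set of a t-cycle-intersecting family, t ≥ 1, is nonempty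
-- (for n ≤ 1 the empty set is excluded since it has n - 1 elements).
generator-nonempty : ∀ {n t} {𝒜 : Family n} {g : SetFam n} {E : Subset n} →
  1 ≤ t → TCycleIntersecting t 𝒜 → IsGenerating 𝒜 g → g E → Nonempty E
generator-nonempty {n} {E = E} 1≤t (_ , intersecting) (sizes , gen) gE with nonempty? E
... | yes nonempty = nonempty
... | no empty = ⊥-elim (absurd n refl)
  where
  ∣E∣≡0 : ∣ E ∣ ≡ 0
  ∣E∣≡0 = trans (cong ∣_∣ (Empty-unique empty)) (∣⊥∣≡0 n)
  absurd : ∀ m → m ≡ n → ⊥
  absurd zero refl = sizes E gE ∣E∣≡0
  absurd (suc zero) refl = sizes E gE ∣E∣≡0
  absurd (suc (suc k)) refl = full-family-not-intersecting 1≤t intersecting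
    (λ σ σ-perm → to (gen σ) (E , gE , σ-perm , λ x∈E → ⊥-elim (empty (_ , x∈E))))

module Characterisation {n} {𝒜 : Family n} {g : SetFam n} {E : Subset n} {s : Fin n}
  (gen* : IsGenerating* 𝒜 g) (compressed : Compressed 𝒜) (gE : g E) (E-max : ∀ B → g B → s⁺ B ≤ s⁺ E)
  (s∈E : s ∈ E) (s⁺≡ : s⁺ E ≡ suc (toℕ s)) where

  open TopElement s∈E s⁺≡

  gen : Upg g ≐ 𝒜
  gen = proj₂ (proj₁ gen*)

  g' : SetFam n
  g' B = g B × B ≢ E

  FixesRest : Arr n → Set
  FixesRest σ = ∀ y → y ∈ E → y ≢ s → ap σ y ≡ y

  other-generator : ∀ σ → ap σ s ≢ s → Upg g σ → Upg g' σ
  other-generator σ σs≢s (B , gB , σ-perm , B⊆fixσ) =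
    B , (gB , λ B≡E → σs≢s (to (∈fix⇔ σ) (B⊆fixσ (subst (s ∈_) (sym B≡E) s∈E)))) , σ-perm , B⊆fixσ

  -- Compression step: if σ fixes E ∖ {s} and a point x ∉ E below s, but moves s, then the
  -- conjugate τ = (x s) σ (x s) fixes E, so τ ∈ 𝒜, hence σ = C_{x,s}(τ) ∈ 𝒜 is generated by g ∖ {E}.
  moving-top⇒other-generator : ∀ σ {x} → IsPerm σ → FixesRest σ → ap σ x ≡ x → x ∉ E →
                               toℕ x < toℕ s → ap σ s ≢ s → ¬ ¬ Upg g' σ
  moving-top⇒other-generator σ {x} σ-perm rest σx≡x x∉E x<s σs≢s not-other =
    compressed-closed compressed x<s τ∈𝒜
      (not-other ∘ other-generator σ σs≢s ∘ from (gen σ) ∘ subst 𝒜 (compress-conjugate σ σ-perm x≢s σx≡x σs≢s))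
    where
    x≢s : x ≢ s
    x≢s = FinP.<⇒≢ x<s
    τ : Arr n
    τ = conjugate x s σ
    τ-fixes-E : ∀ {y} → y ∈ E → ap τ y ≡ y
    τ-fixes-E {y} y∈E with y ≟ s
    ... | yes refl = trans (ap-conjugate x s σ s) (trans (cong (transpose x s ∘ ap σ) (transpose-matchʳ x s))
                       (trans (cong (transpose x s) σx≡x) (transpose-matchˡ x s)))
    ... | no y≢s = trans (ap-conjugate x s σ y) (trans (cong (transpose x s ∘ ap σ) (transpose-other y≢x y≢s))
                     (trans (cong (transpose x s) (rest y y∈E y≢s)) (transpose-other y≢x y≢s)))
      where
      y≢x : y ≢ x
      y≢x y≡x = x∉E (subst (_∈ E) y≡x y∈E)
    τ∈𝒜 : 𝒜 τ
    τ∈𝒜 = to (gen τ) (E , gE , conjugate-perm x s σ σ-perm , λ y∈E → from (∈fix⇔ τ) (τ-fixes-E y∈E))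

  -- When σ fixes s,
  -- apply the compression step to ρ = σ (s c) for a second point c ∉ E, which has fewer fixed points.
  extra-fixed-point⇒other-generator : ∀ σ {x} → IsPerm σ → FixesRest σ → ap σ x ≡ x → x ∉ E →
                                      toℕ x < toℕ s → ¬ ¬ Upg g' σ
  extra-fixed-point⇒other-generator σ {x} σ-perm rest σx≡x x∉E x<s with ap σ s ≟ s
  ... | no σs≢s = moving-top⇒other-generator σ σ-perm rest σx≡x x∉E x<s σs≢s
  ... | yes σs≡s with second-outside-point x∉E (proj₁ (proj₁ gen*) E gE)
  ...   | c , c∉E , c≢x = λ not-other → moving-top⇒other-generator ρ ρ-perm ρ-rest ρx≡x x∉E x<s ρs≢s
                                            (not-other ∘ Upg-mono {ρ = ρ} {σ} σ-perm fixρ⊆fixσ)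
    where
    x≢s : x ≢ s
    x≢s = FinP.<⇒≢ x<s
    c≢s : c ≢ s
    c≢s c≡s = c∉E (subst (_∈ E) (sym c≡s) s∈E)
    ρ : Arr n
    ρ = σ ⊙ transpose s c
    ρ-perm : IsPerm ρ
    ρ-perm = ⊙-perm σ σ-perm (transpose-injective s c)
    ρ-rest : FixesRest ρ
    ρ-rest y y∈E y≢s =
      trans (⊙-transpose-other σ y≢s (λ y≡c → c∉E (subst (_∈ E) y≡c y∈E))) (rest y y∈E y≢s)
    ρx≡x : ap ρ x ≡ x
    ρx≡x = trans (⊙-transpose-other σ x≢s (c≢x ∘ sym)) σx≡x
    ρs≡σc : ap ρ s ≡ ap σ c
    ρs≡σc = trans (ap-⊙ σ _ s) (cong (ap σ) (transpose-matchˡ s c))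
    ρs≢s : ap ρ s ≢ s
    ρs≢s ρs≡s = c≢s (σ-perm c s (trans (sym ρs≡σc) (trans ρs≡s (sym σs≡s))))
    fixρ⊆fixσ : fix ρ ⊆ fix σ
    fixρ⊆fixσ {y} y∈fixρ with to (∈fix⇔ ρ) y∈fixρ | y ≟ s | y ≟ c
    ... | ρy≡y | yes refl | _ = ⊥-elim (ρs≢s ρy≡y)
    ... | ρy≡y | no _ | yes refl = ⊥-elim (c≢s (trans (sym ρy≡y)
                                      (trans (ap-⊙ σ _ y) (trans (cong (ap σ) (transpose-matchʳ s y)) σs≡s))))
    ... | ρy≡y | no y≢s | no y≢c = from (∈fix⇔ σ) (trans (sym (⊙-transpose-other σ y≢s y≢c)) ρy≡y)

  ≤-top-of-generator : ∀ {B y} → g B → y ∈ B → toℕ y ≤ toℕ s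
  ≤-top-of-generator gB y∈B = ℕP.≤-pred (subst (_ ≤_) s⁺≡ (ℕP.≤-trans (s⁺-upper y∈B) (E-max _ gB)))

  below-s⇒generated : ∀ σ → IsPerm σ → SameBelow (toℕ s) (fix σ) E → Up (dropMax E) σ × ¬ Upg g' σ
  below-s⇒generated σ σ-perm same = (σ-perm , rest⊆fixσ) , not-other
    where
    rest⊆fixσ : dropMax E ⊆ fix σ
    rest⊆fixσ y∈ = let y∈E , y≢s = to ∈E∖top⇔ y∈ in from (same _ (<-top y∈E y≢s)) y∈E
    -- a generator B ⊆ fix σ of σ satisfies B ⊆ E, so B = E by minimality
    not-other : ¬ Upg g' σ
    not-other (B , (gB , B≢E) , _ , B⊆fixσ) = B≢E (generator-minimal gen* gE gB B⊆E)
      where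
      B⊆E : B ⊆ E
      B⊆E {y} y∈B with y ≟ s
      ... | yes refl = s∈E
      ... | no y≢s = to (same y (ℕP.≤∧≢⇒< (≤-top-of-generator gB y∈B) (y≢s ∘ FinP.toℕ-injective)))
                        (B⊆fixσ y∈B)

  -- '⊇': a fixed point x ∉ E below s would make σ generated by g ∖ {E}
  generated⇒below-s : ∀ σ → Up (dropMax E) σ × ¬ Upg g' σ → IsPerm σ × SameBelow (toℕ s) (fix σ) E
  generated⇒below-s σ ((σ-perm , rest⊆fixσ) , not-other) = σ-perm , same
    where
    rest : FixesRest σ
    rest y y∈E y≢s = to (∈fix⇔ σ) (rest⊆fixσ (from ∈E∖top⇔ (y∈E , y≢s)))
    same : SameBelow (toℕ s) (fix σ) E
    same x x<s = mk⇔ fixed⇒∈E (λ x∈E → from (∈fix⇔ σ) (rest x x∈E (FinP.<⇒≢ x<s)))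
      where
      fixed⇒∈E : x ∈ fix σ → x ∈ E
      fixed⇒∈E x∈fixσ with x ∈? E
      ... | yes x∈E = x∈E
      ... | no x∉E =
        ⊥-elim (extra-fixed-point⇒other-generator σ σ-perm rest (to (∈fix⇔ σ) x∈fixσ) x∉E x<s not-other)

  characterisation : 𝒟' E ≐ (λ σ → Up (dropMax E) σ × ¬ Upg g' σ)
  characterisation σ =
    mk⇔ (uncurry (below-s⇒generated σ) ∘ to (𝒟'⇔ {σ})) (from (𝒟'⇔ {σ}) ∘ generated⇒below-s σ)

unique-⊆-length : ∀ {A : Set} (xs ys : List A) → Unique xs → (∀ {x} → x ∈ₗ xs → x ∈ₗ ys) →
                  length xs ≤ length ys
unique-⊆-length [] ys _ _ = z≤n
unique-⊆-length (x ∷ xs) ys (x∉xs AllPairs.∷ xs-unique) xs⊆ys with ∈-∃++ (xs⊆ys (here refl))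
... | ys₁ , ys₂ , refl = begin
  suc (length xs)               ≤⟨ s≤s (unique-⊆-length xs (ys₁ ++ ys₂) xs-unique xs⊆rest) ⟩
  suc (length (ys₁ ++ ys₂))     ≡⟨ cong suc (ListP.length-++ ys₁) ⟩
  suc (length ys₁ + length ys₂) ≡⟨ sym (ℕP.+-suc (length ys₁) (length ys₂)) ⟩
  length ys₁ + length (x ∷ ys₂) ≡⟨ sym (ListP.length-++ ys₁) ⟩
  length (ys₁ ++ x ∷ ys₂)       ∎
  where
  open ℕP.≤-Reasoning
  xs⊆rest : ∀ {y} → y ∈ₗ xs → y ∈ₗ ys₁ ++ ys₂
  xs⊆rest {y} y∈xs with ∈-++⁻ ys₁ (xs⊆ys (there y∈xs))
  ... | inj₁ y∈ys₁ = ∈-++⁺ˡ y∈ys₁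
  ... | inj₂ (here y≡x) = ⊥-elim (All.lookup x∉xs y∈xs (sym y≡x))
  ... | inj₂ (there y∈ys₂) = ∈-++⁺ʳ ys₁ y∈ys₂

map-unique : ∀ {A B : Set} (f : A → B) (xs : List A) → Unique xs →
             (∀ {a b} → a ∈ₗ xs → b ∈ₗ xs → f a ≡ f b → a ≡ b) → Unique (map f xs)
map-unique f [] _ _ = AllPairs.[]
map-unique f (x ∷ xs) (x∉xs AllPairs.∷ xs-unique) f-inj =
  All.map⁺ (All.tabulate λ b∈xs fx≡fb → All.lookup x∉xs b∈xs (f-inj (here refl) (there b∈xs) fx≡fb))
  AllPairs.∷ map-unique f xs xs-unique (λ a∈ b∈ → f-inj (there a∈) (there b∈))

length-cartesianProduct : ∀ {A B : Set} (xs : List A) (ys : List B) →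
                          length (cartesianProduct xs ys) ≡ length xs * length ys
length-cartesianProduct [] ys = refl
length-cartesianProduct (x ∷ xs) ys = begin
  length (map (x ,_) ys ++ cartesianProduct xs ys)          ≡⟨ ListP.length-++ (map (x ,_) ys) ⟩
  length (map (x ,_) ys) + length (cartesianProduct xs ys)  ≡⟨ cong₂ _+_ (ListP.length-map (x ,_) ys)
                                                                          (length-cartesianProduct xs ys) ⟩
  length ys + length xs * length ys                         ∎
  where open ≡-Reasoning

allVecs'-as-product : ∀ n k → allVecs' n (suc k) ≡ cartesianProductWith Vec._∷_ (allFin n) (allVecs' n k)
allVecs'-as-product n k = go (allFin n)
  where
  go : ∀ xs → concatMap (λ x → map (x Vec.∷_) (allVecs' n k)) xs ≡ cartesianProductWith Vec._∷_ xs (allVecs' n k)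
  go [] = refl
  go (x ∷ xs) = cong (map (x Vec.∷_) (allVecs' n k) ++_) (go xs)

allVecs'-unique : ∀ n k → Unique (allVecs' n k)
allVecs'-unique n zero = All.[] AllPairs.∷ AllPairs.[]
allVecs'-unique n (suc k) = subst Unique (sym (allVecs'-as-product n k))
  (Unique.cartesianProductWith⁺ Vec._∷_ ∷-injective (Unique.allFin⁺ n) (allVecs'-unique n k))

allVecs'-complete : ∀ n k (v : Vec (Fin n) k) → v ∈ₗ allVecs' n k
allVecs'-complete n zero Vec.[] = here refl
allVecs'-complete n (suc k) (x Vec.∷ v) = subst ((x Vec.∷ v) ∈ₗ_) (sym (allVecs'-as-product n k))
  (∈-cartesianProductWith⁺ Vec._∷_ (∈-allFin x) (allVecs'-complete n k v))

card-product-≤ : ∀ {n} {Y : Set} (P Q : Family n) (P? : Decidable P) (Q? : Decidable Q) (ys : List Y) →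
  Unique ys → (F : Arr n → Y → Arr n) →
  (∀ {σ y} → P σ → y ∈ₗ ys → Q (F σ y)) →
  (∀ {σ σ' y y'} → P σ → P σ' → F σ y ≡ F σ' y' → σ ≡ σ' × y ≡ y') →
  length ys * card P P? ≤ card Q Q?
card-product-≤ {n} {Y} P Q P? Q? ys ys-unique F F-into F-injective = begin
  length ys * length Ps           ≡⟨ ℕP.*-comm (length ys) (length Ps) ⟩
  length Ps * length ys           ≡⟨ sym (length-cartesianProduct Ps ys) ⟩
  length pairs                    ≡⟨ sym (ListP.length-map (uncurry F) pairs) ⟩
  length (map (uncurry F) pairs)  ≤⟨ unique-⊆-length _ _ images-unique images-in-Q ⟩
  card Q Q?                       ∎
  where
  open ℕP.≤-Reasoning
  Ps : List (Arr n)
  Ps = filter P? (allVecs' n n)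
  pairs : List (Arr n × Y)
  pairs = cartesianProduct Ps ys
  P-of : ∀ {σ y} → (σ , y) ∈ₗ pairs → P σ × y ∈ₗ ys
  P-of σy∈ = let σ∈Ps , y∈ys = ∈-cartesianProduct⁻ Ps ys σy∈
             in proj₂ (∈-filter⁻ P? {xs = allVecs' n n} σ∈Ps) , y∈ys
  images-unique : Unique (map (uncurry F) pairs)
  images-unique = map-unique (uncurry F) pairs
    (Unique.cartesianProduct⁺ (Unique.filter⁺ P? (allVecs'-unique n n)) ys-unique)
    (λ { {σ , y} {σ' , y'} a∈ b∈ e →
         let σ≡σ' , y≡y' = F-injective (proj₁ (P-of a∈)) (proj₁ (P-of b∈)) e in cong₂ _,_ σ≡σ' y≡y' })
  images-in-Q : ∀ {τ} → τ ∈ₗ map (uncurry F) pairs → τ ∈ₗ filter Q? (allVecs' n n)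
  images-in-Q τ∈ with ∈-map⁻ (uncurry F) τ∈
  ... | (σ , y) , σy∈ , refl =
    ∈-filter⁺ Q? (allVecs'-complete n n _) (F-into (proj₁ (P-of σy∈)) (proj₂ (P-of σy∈)))

length-filter-∈-suc : ∀ {n} b (p : Subset n) (xs : List (Fin n)) →
  length (filter (_∈? (b Vec.∷ p)) (map Fin.suc xs)) ≡ length (filter (_∈? p) xs)
length-filter-∈-suc b p [] = refl
length-filter-∈-suc b p (x ∷ xs) with does (x ∈? p)
... | true = cong suc (length-filter-∈-suc b p xs)
... | false = length-filter-∈-suc b p xs

length-filter-∈-tail : ∀ {n} b (p : Subset n) →
  length (filter (_∈? (b Vec.∷ p)) (Data.List.tabulate Fin.suc)) ≡ ∣ p ∣

length-filter-∈ : ∀ {n} (p : Subset n) → length (filter (_∈? p) (allFin n)) ≡ ∣ p ∣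
length-filter-∈ {zero} Vec.[] = refl
length-filter-∈ {suc n} (true Vec.∷ p) = cong suc (length-filter-∈-tail true p)
length-filter-∈ {suc n} (false Vec.∷ p) = length-filter-∈-tail false p

length-filter-∈-tail {n} b p = begin
  length (filter (_∈? (b Vec.∷ p)) (Data.List.tabulate Fin.suc)) ≡⟨ cong (length ∘ filter (_∈? (b Vec.∷ p)))
                                                                    (sym (ListP.map-tabulate (λ x → x) Fin.suc)) ⟩
  length (filter (_∈? (b Vec.∷ p)) (map Fin.suc (allFin n)))     ≡⟨ length-filter-∈-suc b p (allFin n) ⟩
  length (filter (_∈? p) (allFin n))                              ≡⟨ length-filter-∈ p ⟩
  ∣ p ∣                                                          ∎
  where open ≡-Reasoning

-- The second claim: (n - |E| + 1) |𝒟(E)| ≤ |𝒟'(E)|, s = max E.  For σ ∈ 𝒟(E) and y ∈ {s} ∪ ([n] ∖ E)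
-- the permutation σ (s y) lies in 𝒟'(E); it sends y to s, so it determines y and then σ.
module Counting {n} {E : Subset n} {s : Fin n} (s∈E : s ∈ E) (s⁺≡ : s⁺ E ≡ suc (toℕ s)) where

  open TopElement s∈E s⁺≡

  swap-points : List (Fin n)
  swap-points = s ∷ filter (_∈? ∁ E) (allFin n)

  swap-point : ∀ {y} → y ∈ₗ swap-points → y ≡ s ⊎ y ∉ E
  swap-point (here y≡s) = inj₁ y≡s
  swap-point (there y∈) = inj₂ (x∈∁p⇒x∉p (proj₂ (∈-filter⁻ (_∈? ∁ E) {xs = allFin n} y∈)))

  swap-points-unique : Unique swap-points
  swap-points-unique =
    All.tabulate (λ y∈ s≡y → x∈∁p⇒x∉p (proj₂ (∈-filter⁻ (_∈? ∁ E) {xs = allFin n} y∈)) (subst (_∈ E) s≡y s∈E))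
    AllPairs.∷ Unique.filter⁺ (_∈? ∁ E) (Unique.allFin⁺ n)

  swap-points-length : length swap-points ≡ n ∸ ∣ E ∣ + 1
  swap-points-length = begin
    suc (length (filter (_∈? ∁ E) (allFin n))) ≡⟨ cong suc (length-filter-∈ (∁ E)) ⟩
    suc ∣ ∁ E ∣                                 ≡⟨ cong suc (∣∁p∣≡n∸∣p∣ E) ⟩
    suc (n ∸ ∣ E ∣)                             ≡⟨ ℕP.+-comm 1 (n ∸ ∣ E ∣) ⟩
    n ∸ ∣ E ∣ + 1                               ∎
    where open ≡-Reasoning

  fixes-top : ∀ σ → 𝒟 E σ → ap σ s ≡ s
  fixes-top σ σ∈𝒟 = to (∈fix⇔ σ) (from (proj₂ (to (𝒟⇔ {σ}) σ∈𝒟) s (ℕP.n<1+n (toℕ s))) s∈E)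

  sends-to-top : ∀ σ y → 𝒟 E σ → ap (σ ⊙ transpose s y) y ≡ s
  sends-to-top σ y σ∈𝒟 = trans (ap-⊙ σ _ y) (trans (cong (ap σ) (transpose-matchʳ s y)) (fixes-top σ σ∈𝒟))

  fix-at : ∀ (ρ σ : Arr n) {x} → ap ρ x ≡ ap σ x → x ∈ fix ρ ⇔ x ∈ fix σ
  fix-at ρ σ ρx≡σx = ⇔-trans (∈fix⇔ ρ) (⇔-trans (mk⇔ (trans (sym ρx≡σx)) (trans ρx≡σx)) (⇔-sym (∈fix⇔ σ)))

  -- σ (s y) agrees with σ below s except at y, which it moves and which is not in E
  swap-into-𝒟' : ∀ {σ y} → 𝒟 E σ → y ≡ s ⊎ y ∉ E → 𝒟' E (σ ⊙ transpose s y)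
  swap-into-𝒟' {σ} {y} σ∈𝒟 y-ok =
    from (𝒟'⇔ {σ ⊙ transpose s y}) (⊙-perm σ σ-perm (transpose-injective s y) , same)
    where
    σ-perm : IsPerm σ
    σ-perm = proj₁ (to (𝒟⇔ {σ}) σ∈𝒟)
    ρ : Arr n
    ρ = σ ⊙ transpose s y
    same : SameBelow (toℕ s) (fix ρ) E
    same x x<s with x ≟ y
    ... | yes refl = mk⇔ (λ x∈fixρ → ⊥-elim (x≢s (trans (sym (to (∈fix⇔ ρ) x∈fixρ)) (sends-to-top σ x σ∈𝒟))))
                         (λ x∈E → ⊥-elim ([ x≢s , (λ x∉E → x∉E x∈E) ] y-ok))
      where
      x≢s : x ≢ s
      x≢s = FinP.<⇒≢ x<s
    ... | no x≢y = ⇔-trans (fix-at ρ σ (⊙-transpose-other σ (FinP.<⇒≢ x<s) x≢y))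
                           (proj₂ (to (𝒟⇔ {σ}) σ∈𝒟) x (ℕP.m≤n⇒m≤1+n x<s))

  -- y is the point that σ (s y) sends to s, and then σ = σ (s y) (s y)
  swap-injective : ∀ {σ σ' y y'} → 𝒟 E σ → 𝒟 E σ' → σ ⊙ transpose s y ≡ σ' ⊙ transpose s y' →
                   σ ≡ σ' × y ≡ y'
  swap-injective {σ} {σ'} {y} {y'} σ∈𝒟 σ'∈𝒟 e = σ≡σ' y≡y' e , y≡y'
    where
    y≡y' : y ≡ y'
    y≡y' = ⊙-perm σ (proj₁ (to (𝒟⇔ {σ}) σ∈𝒟)) (transpose-injective s y) y y'
             (trans (sends-to-top σ y σ∈𝒟) (sym (trans (cong (λ ρ → ap ρ y') e) (sends-to-top σ' y' σ'∈𝒟))))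
    σ≡σ' : y ≡ y' → σ ⊙ transpose s y ≡ σ' ⊙ transpose s y' → σ ≡ σ'
    σ≡σ' refl = ⊙-cancel (transpose s y) (transpose y s) (λ _ → transpose-inverse s y)

  count : (n ∸ ∣ E ∣ + 1) * card (𝒟 E) (𝒟? E) ≤ card (𝒟' E) (𝒟'? E)
  count = subst (λ k → k * card (𝒟 E) (𝒟? E) ≤ card (𝒟' E) (𝒟'? E)) swap-points-length
    (card-product-≤ (𝒟 E) (𝒟' E) (𝒟? E) (𝒟'? E) swap-points swap-points-unique
      (λ σ y → σ ⊙ transpose s y)
      (λ {σ} σ∈𝒟 y∈ → swap-into-𝒟' {σ} σ∈𝒟 (swap-point y∈)) swap-injective)

-- Lemma 2.16.  Ê is nonempty, so it has a largest element s with s⁺ Ê = s + 1; both claims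
-- then follow from the two modules above.
lemma2p16 : ∀ {n : ℕ} (t : ℕ) (𝒜 : Family n) (g : SetFam n) (Ê : Subset n) →
    1 ≤ t → Maximal t 𝒜 → Fixed 𝒜 → Compressed 𝒜 → IsGenerating* 𝒜 g →
    g Ê → (∀ E → g E → s⁺ E ≤ s⁺ Ê) →
    (𝒟' Ê ≐ (λ σ → Up (dropMax Ê) σ × ¬ Upg (λ E → g E × E ≢ Ê) σ)) ×
    ((n ∸ ∣ Ê ∣ + 1) * card (𝒟 Ê) (𝒟? Ê) ≤ card (𝒟' Ê) (𝒟'? Ê))
lemma2p16 t 𝒜 g Ê 1≤t maximal _ compressed gen* gÊ Ê-max
  with s⁺-attained (generator-nonempty 1≤t (proj₁ maximal) (proj₁ gen*) gÊ)
... | s , s∈Ê , s⁺≡ =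
  Characterisation.characterisation gen* compressed gÊ Ê-max s∈Ê s⁺≡ , Counting.count s∈Ê s⁺≡
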